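{- Let $C=C_0(d)$ or $C=C(d)$ for a fixed integer $d\ge1$, let $\tau$ be an integer, and let $\epsilon,\delta>0$ be sufficiently small constants. Let $|C|^{(1-\epsilon)n}\le M\le|C|^{(1+\epsilon)n}$. Let $z\in C\setminus\{0\}$, $D=\{w-z:w\in C\}$, and let $\sigma$ be a solution profile with respect to $D$ with \[ |\sigma|\le\Big(\frac{|C|-1}{|C|}+\frac{\delta}{|C|-1}\Big)n. \] Then with probability $1-e^{ -\Omega(n)}$ over $\vec{\bm x}$ drawn uniformly from $[0:M-1]^n$, either there is no input partition $\mathbb S$ corresponding to $\sigma$ with $\mathrm{sig}(\mathbb S,\vec{\bm x})=\tau-z\sum_{i\in[n]}\bm x_i$, or there is such an input partition $\mathbb S$ whose half-partitions have at least $\Omega(a(\sigma))$ distinct signatures under $\vec{\bm x}$.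
   Context: $[a:b]=\{a,\dots,b\}$, $[n]=\{1,\dots,n\}$, $C(d)=\{\pm1,\dots,\pm d\}$, $C_0(d)=\{0,\pm1,\dots,\pm d\}$; note $0\in D$. A solution profile with respect to $D$ is a tuple $(\sigma_w)_{w\in D}$ of nonnegative integers summing to $n$, of size $|\sigma|=n-\sigma_0$. An input partition with respect to $D$ is a tuple $\mathbb S=(S_w)_{w\in D}$ of pairwise disjoint sets with union $[n]$; it corresponds to $\sigma$ if $|S_w|=\sigma_w$ for all $w$. A half-partition of $\mathbb S$ is a tuple $\mathbb T=(T_w)_{w\in D\setminus\{0\}}$ with $T_w\subseteq S_w$, where $|T_w|=\sigma_w/2$ if $\sigma_w$ is even and $|T_w|\in\{(\sigma_w\pm1)/2\}$ if $\sigma_w$ is odd. Signatures: $\mathrm{sig}(\mathbb T,\vec x)=\sum_{w\in D\setminus\{0\}}w\sum_{i\in T_w}x_i$ and $\mathrm{sig}(\mathbb S,\vec x)=\sum_{w\in D\setminus\{0\}}w\sum_{i\in S_w}x_i$. $a(\sigma)$ is the number of half-partitions of any input partition corresponding to $\sigma$ (it depends only on $\sigma$ and equals $2^{|\sigma|}$ up to polynomial factors in $n$). -}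

module Defs where

open import Data.Bool using (Bool; true; false; _∧_; _∨_; not; if_then_else_)
open import Data.Nat as ℕ using (ℕ; zero; suc; _≡ᵇ_; _≤ᵇ_)
open import Data.Integer as ℤ using (ℤ; +_)
open import Data.List as L using (List; []; _∷_)
open import Data.Vec as V using (Vec; []; _∷_)
open import Relation.Nullary.Decidable using (⌊_⌋)
open import Relation.Binary.PropositionalEquality using (_≡_)
open import Data.Bool.ListAction using (all; any)
import Data.Nat.ListAction as NL

posList : ℕ → List ℤ
posList d = L.map (λ i → + suc i) (L.upTo d)

Cd : ℕ → List ℤ
Cd d = posList d L.++ L.map ℤ.-_ (posList d)

C0d : ℕ → List ℤ
C0d d = + 0 ∷ Cd d

Cset : Bool → ℕ → List ℤ
Cset true d = C0d d
Cset false d = Cd d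

Dset : List ℤ → ℤ → List ℤ
Dset C z = L.map (λ w → w ℤ.- z) C

eqℤ : ℤ → ℤ → Bool
eqℤ a b = ⌊ a ℤ.≟ b ⌋

sumℕList : List ℕ → ℕ
sumℕList = NL.sum

allVecs : {A : Set} → List A → (n : ℕ) → List (Vec A n)
allVecs xs zero = [] ∷ []
allVecs xs (suc n) = L.concatMap (λ v → L.map (λ a → a ∷ v) xs) (allVecs xs n)

-- An input partition S = (S_w)_{w∈D} of [n] is represented by its labelling
-- vector: entry i is the unique w ∈ D with i ∈ S_w.  allPartitions D n lists all of them.
allPartitions : List ℤ → (n : ℕ) → List (Vec ℤ n)
allPartitions D n = allVecs D n

countLabel : {n : ℕ} → ℤ → Vec ℤ n → ℕ
countLabel w [] = 0
countLabel w (s ∷ S) = (if eqℤ s w then 1 else 0) ℕ.+ countLabel w S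

-- solution profile σ w.r.t. D (σ given on all ℤ; only its values on D matter)
isProfile : List ℤ → (n : ℕ) → (ℤ → ℕ) → Set
isProfile D n σ = sumℕList (L.map σ D) ≡ n

profileSize : (n : ℕ) → (ℤ → ℕ) → ℕ
profileSize n σ = n ℕ.∸ σ (+ 0)

corresponds : List ℤ → (ℤ → ℕ) → {n : ℕ} → Vec ℤ n → Bool
corresponds D σ S = all (λ w → countLabel w S ≡ᵇ σ w) D

-- A half-partition T = (T_w)_{w∈D∖{0}} of S is represented by the indicator
-- vector of ⋃ T_w (T_w = that set ∩ S_w), required to avoid S_0.
-- |T_w ∩ S_w| = t
countHalf : {n : ℕ} → ℤ → Vec ℤ n → Vec Bool n → ℕ
countHalf w [] [] = 0
countHalf w (s ∷ S) (b ∷ T) = (if eqℤ s w ∧ b then 1 else 0) ℕ.+ countHalf w S T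

avoidsZero : {n : ℕ} → Vec ℤ n → Vec Bool n → Bool
avoidsZero [] [] = true
avoidsZero (s ∷ S) (b ∷ T) = not (eqℤ s (+ 0) ∧ b) ∧ avoidsZero S T

halfSize : ℕ → ℕ → Bool
halfSize t s = ((2 ℕ.* t) ≡ᵇ s) ∨ ((2 ℕ.* t) ≡ᵇ suc s) ∨ (suc (2 ℕ.* t) ≡ᵇ s)

isHalfPartition : List ℤ → {n : ℕ} → Vec ℤ n → Vec Bool n → Bool
isHalfPartition D S T =
  avoidsZero S T ∧ all (λ w → eqℤ w (+ 0) ∨ halfSize (countHalf w S T) (countLabel w S)) D

halfPartitions : List ℤ → {n : ℕ} → Vec ℤ n → List (Vec Bool n)
halfPartitions D {n} S = L.filterᵇ (isHalfPartition D S) (allVecs (true ∷ false ∷ []) n)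

-- number of half-partitions of S (this is a(σ) when S corresponds to σ)
numHalf : List ℤ → {n : ℕ} → Vec ℤ n → ℕ
numHalf D S = L.length (halfPartitions D S)

sigS : {n : ℕ} → Vec ℤ n → Vec ℕ n → ℤ
sigS [] [] = + 0
sigS (s ∷ S) (x ∷ xs) = s ℤ.* + x ℤ.+ sigS S xs

sigT : {n : ℕ} → Vec ℤ n → Vec Bool n → Vec ℕ n → ℤ
sigT [] [] [] = + 0
sigT (s ∷ S) (b ∷ T) (x ∷ xs) = (if b then s ℤ.* + x else + 0) ℤ.+ sigT S T xs

distinctSigs : List ℤ → {n : ℕ} → Vec ℤ n → Vec ℕ n → ℕ
distinctSigs D S x = L.length (L.deduplicate ℤ._≟_ (L.map (λ T → sigT S T x) (halfPartitions D S)))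

sumVec : {n : ℕ} → Vec ℕ n → ℕ
sumVec = V.sum

isSolution : List ℤ → (ℤ → ℕ) → ℤ → ℤ → {n : ℕ} → Vec ℕ n → Vec ℤ n → Bool
isSolution D σ τ z x S = corresponds D σ S ∧ eqℤ (sigS S x) (τ ℤ.- z ℤ.* + sumVec x)

manySigs : List ℤ → ℕ → ℕ → {n : ℕ} → Vec ℕ n → Vec ℤ n → Bool
manySigs D cn cd x S = (cn ℕ.* numHalf D S) ≤ᵇ (cd ℕ.* distinctSigs D S x)

badInput : List ℤ → (ℤ → ℕ) → ℤ → ℤ → ℕ → ℕ → {n : ℕ} → Vec ℕ n → Bool
badInput D σ τ z cn cd {n} x =
  any (isSolution D σ τ z x) (allPartitions D n)
  ∧ not (any (λ S → isSolution D σ τ z x S ∧ manySigs D cn cd x S) (allPartitions D n))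

badCount : List ℤ → (ℤ → ℕ) → ℤ → ℤ → ℕ → ℕ → (n M : ℕ) → ℕ
badCount D σ τ z cn cd n M = L.length (L.filterᵇ (badInput D σ τ z cn cd) (allVecs (L.upTo M) n))

-- Fix an input partition S with a label-0 position (one exists because |σ| < n) and call x poor
-- for S when S solves sig(S,x) = τ − zΣx but its half-partitions have fewer than a(σ)/2 distinct
-- signatures.  Then at least a(σ)/2 pairs of distinct half-partitions collide.  A collision is a
-- linear condition ⟨T − T′, x⟩ = 0 with a nonzero form vanishing at every label-0 position, while
-- the solution condition ⟨S + z, x⟩ = τ has coefficient z ≠ 0 there; the two are independent, so
-- each pair is met by at most M^(n−2) points of [0,M)^n.  Hence S has at most 2a(σ)M^(n−2) poor x,
-- and as a(σ) ≤ 2^(number of nonzero labels of S), summing over S bounds the bad inputs by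
-- 2(2|C|−1)^n M^(n−2).  Since 2|C|−1 < |C|² and M² ≥ |C|^(2(1−εa/εb)n), this is exponentially
-- smaller than M^n; Bernoulli's inequality makes the rate explicit.

module Submission where

module Counting where

  open import Data.Bool using (Bool; true; false; _∧_; T)
  open import Data.Bool.Properties using (T-∧)
  open import Data.Nat using (ℕ; zero; suc; _+_; _*_; _^_; _≤_; z≤n; s≤s)
  open import Data.Nat.Properties
  open import Algebra.Properties.CommutativeSemigroup +-commutativeSemigroup using (interchange)
  open import Data.List using (List; []; _∷_; length; map; filterᵇ; concatMap; _++_)
  open import Data.List.Properties using (length-++; length-map)
  open import Data.List.Relation.Unary.All as All using (All; []; _∷_)
  open import Data.List.Relation.Unary.AllPairs using ([]; _∷_)
  import Data.List.Relation.Unary.AllPairs.Properties as AllPairs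
  open import Data.List.Relation.Unary.Unique.Propositional using (Unique)
  import Data.List.Relation.Unary.Unique.Propositional.Properties as Unique
  import Data.List.Relation.Unary.All.Properties as All
  open import Data.Vec using (Vec; _∷_)
  open import Data.Vec.Properties using (∷-injectiveˡ; ∷-injectiveʳ)
  open import Data.Empty using (⊥-elim)
  open import Data.Product using (_×_; _,_)
  open import Function using (Equivalence)
  open import Relation.Nullary using (¬_)
  open import Relation.Binary.PropositionalEquality
  open import Defs using (allVecs)

  private variable
    A B : Set
    n : ℕ

  ∧⁻ : ∀ {a b} → T (a ∧ b) → T a × T b
  ∧⁻ {a} = Equivalence.to (T-∧ {a})

  ∧⁺ : ∀ {a b} → T a → T b → T (a ∧ b)
  ∧⁺ {a} ta tb = Equivalence.from (T-∧ {a}) (ta , tb)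

  sumBy : (A → ℕ) → List A → ℕ
  sumBy f []       = 0
  sumBy f (x ∷ xs) = f x + sumBy f xs

  indicator : Bool → ℕ
  indicator true  = 1
  indicator false = 0

  count : (A → Bool) → List A → ℕ
  count p = sumBy (λ x → indicator (p x))

  length-filterᵇ : (p : A → Bool) (xs : List A) → length (filterᵇ p xs) ≡ count p xs
  length-filterᵇ p []       = refl
  length-filterᵇ p (x ∷ xs) with p x
  ... | true  = cong suc (length-filterᵇ p xs)
  ... | false = length-filterᵇ p xs

  sumBy-mono : {f g : A → ℕ} {xs : List A} → All (λ x → f x ≤ g x) xs → sumBy f xs ≤ sumBy g xs
  sumBy-mono []       = z≤n
  sumBy-mono (h ∷ hs) = +-mono-≤ h (sumBy-mono hs)

  sumBy-cong : {f g : A → ℕ} (xs : List A) → (∀ x → f x ≡ g x) → sumBy f xs ≡ sumBy g xs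
  sumBy-cong []       h = refl
  sumBy-cong (x ∷ xs) h = cong₂ _+_ (h x) (sumBy-cong xs h)

  sumBy-+ : (f g : A → ℕ) (xs : List A) → sumBy (λ x → f x + g x) xs ≡ sumBy f xs + sumBy g xs
  sumBy-+ f g []       = refl
  sumBy-+ f g (x ∷ xs) = begin
    f x + g x + sumBy (λ x → f x + g x) xs ≡⟨ cong (f x + g x +_) (sumBy-+ f g xs) ⟩
    f x + g x + (sumBy f xs + sumBy g xs)  ≡⟨ interchange (f x) (g x) (sumBy f xs) (sumBy g xs) ⟩
    f x + sumBy f xs + (g x + sumBy g xs)  ∎
    where open ≡-Reasoning

  sumBy-*ˡ : (c : ℕ) (f : A → ℕ) (xs : List A) → sumBy (λ x → c * f x) xs ≡ c * sumBy f xs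
  sumBy-*ˡ c f []       = sym (*-zeroʳ c)
  sumBy-*ˡ c f (x ∷ xs) = trans (cong (c * f x +_) (sumBy-*ˡ c f xs)) (sym (*-distribˡ-+ c (f x) (sumBy f xs)))

  sumBy-*ʳ : (c : ℕ) (f : A → ℕ) (xs : List A) → sumBy f xs * c ≡ sumBy (λ x → f x * c) xs
  sumBy-*ʳ c f xs = begin
    sumBy f xs * c             ≡⟨ *-comm (sumBy f xs) c ⟩
    c * sumBy f xs             ≡⟨ sumBy-*ˡ c f xs ⟨
    sumBy (λ x → c * f x) xs   ≡⟨ sumBy-cong xs (λ x → *-comm c (f x)) ⟩
    sumBy (λ x → f x * c) xs   ∎
    where open ≡-Reasoning

  sumBy-const : (c : ℕ) (xs : List A) → sumBy (λ _ → c) xs ≡ length xs * c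
  sumBy-const c []       = refl
  sumBy-const c (x ∷ xs) = cong (c +_) (sumBy-const c xs)

  sumBy-++ : (f : A → ℕ) (xs ys : List A) → sumBy f (xs ++ ys) ≡ sumBy f xs + sumBy f ys
  sumBy-++ f []       ys = refl
  sumBy-++ f (x ∷ xs) ys = trans (cong (f x +_) (sumBy-++ f xs ys)) (sym (+-assoc (f x) (sumBy f xs) (sumBy f ys)))

  sumBy-map : (f : B → ℕ) (g : A → B) (xs : List A) → sumBy f (map g xs) ≡ sumBy (λ x → f (g x)) xs
  sumBy-map f g []       = refl
  sumBy-map f g (x ∷ xs) = cong (f (g x) +_) (sumBy-map f g xs)

  sumBy-concatMap : (f : B → ℕ) (g : A → List B) (xs : List A) →
                    sumBy f (concatMap g xs) ≡ sumBy (λ x → sumBy f (g x)) xs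
  sumBy-concatMap f g []       = refl
  sumBy-concatMap f g (x ∷ xs) = trans (sumBy-++ f (g x) (concatMap g xs)) (cong (sumBy f (g x) +_) (sumBy-concatMap f g xs))

  sumBy-swap : (f : A → B → ℕ) (xs : List A) (ys : List B) →
               sumBy (λ x → sumBy (f x) ys) xs ≡ sumBy (λ y → sumBy (λ x → f x y) xs) ys
  sumBy-swap f []       ys = sym (trans (sumBy-const 0 ys) (*-zeroʳ (length ys)))
  sumBy-swap f (x ∷ xs) ys = trans (cong (sumBy (f x) ys +_) (sumBy-swap f xs ys)) (sym (sumBy-+ (f x) _ ys))

  sumBy≤length* : {f : A → ℕ} {d : ℕ} {xs : List A} → All (λ x → f x ≤ d) xs → sumBy f xs ≤ length xs * d
  sumBy≤length* {d = d} {xs} h = ≤-trans (sumBy-mono h) (≤-reflexive (sumBy-const d xs))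

  indicator-mono : ∀ {a b} → (T a → T b) → indicator a ≤ indicator b
  indicator-mono {false}        h = z≤n
  indicator-mono {true} {true}  h = ≤-refl
  indicator-mono {true} {false} h = ⊥-elim (h _)

  count-mono : {p q : A → Bool} (xs : List A) → (∀ x → T (p x) → T (q x)) → count p xs ≤ count q xs
  count-mono xs h = sumBy-mono (All.universal (λ x → indicator-mono (h x)) xs)

  count-none : {p : A → Bool} {xs : List A} → All (λ x → ¬ T (p x)) xs → count p xs ≡ 0
  count-none                 []       = refl
  count-none {p = p} {x ∷ _} (h ∷ hs) with p x
  ... | true  = ⊥-elim (h _)
  ... | false = count-none hs

  count-unique≤1 : {p : A → Bool} (xs : List A) → Unique xs →
                   (∀ x y → T (p x) → T (p y) → x ≡ y) → count p xs ≤ 1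
  count-unique≤1 []                 _              _   = z≤n
  count-unique≤1 {p = p} (x ∷ xs) (x∉xs ∷ unique) inj with p x in px
  ... | true  = s≤s (≤-reflexive (count-none (All.map (λ x≢y py → x≢y (inj _ _ (subst T (sym px) _) py)) x∉xs)))
  ... | false = count-unique≤1 xs unique inj

  count≤indicator : {p : A → Bool} {q : Bool} (xs : List A) →
                    (∀ x → T (p x) → T q) → count p xs ≤ 1 → count p xs ≤ indicator q
  count≤indicator {q = true}  xs _ h = h
  count≤indicator {q = false} xs h _ = ≤-reflexive (count-none (All.universal h xs))

  sumBy-allVecs : (f : Vec A (suc n) → ℕ) (xs : List A) →
                  sumBy f (allVecs xs (suc n)) ≡ sumBy (λ v → sumBy (λ a → f (a ∷ v)) xs) (allVecs xs n)
  sumBy-allVecs {n = n} f xs = trans (sumBy-concatMap f _ (allVecs xs n)) (sumBy-cong (allVecs xs n) (λ v → sumBy-map f (_∷ v) xs))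

  length-allVecs : {A : Set} (xs : List A) (n : ℕ) → length (allVecs xs n) ≡ length xs ^ n
  length-allVecs xs zero    = refl
  length-allVecs {A} xs (suc n) = begin
    length (concatMap (λ v → map (_∷ v) xs) (allVecs xs n)) ≡⟨ length-layers (allVecs xs n) ⟩
    length xs * length (allVecs xs n)                      ≡⟨ cong (length xs *_) (length-allVecs xs n) ⟩
    length xs * length xs ^ n                              ∎
    where
    open ≡-Reasoning
    length-layers : (vs : List (Vec A n)) → length (concatMap (λ v → map (_∷ v) xs) vs) ≡ length xs * length vs
    length-layers []       = sym (*-zeroʳ (length xs))
    length-layers (v ∷ vs) = begin
      length (map (_∷ v) xs ++ concatMap (λ v → map (_∷ v) xs) vs) ≡⟨ length-++ (map (_∷ v) xs) ⟩
      length (map (_∷ v) xs) + length (concatMap (λ v → map (_∷ v) xs) vs)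
        ≡⟨ cong₂ _+_ (length-map (_∷ v) xs) (length-layers vs) ⟩
      length xs + length xs * length vs ≡⟨ *-suc (length xs) (length vs) ⟨
      length xs * suc (length vs) ∎

  allVecs⁺ : {A : Set} {xs : List A} → Unique xs → ∀ n → Unique (allVecs xs n)
  allVecs⁺         _        zero    = [] ∷ []
  allVecs⁺ {A} {xs} unique (suc n) = layers (allVecs⁺ unique n)
    where
    fresh : ∀ {v} {vs : List (Vec A n)} a → All (v ≢_) vs → All ((a ∷ v) ≢_) (concatMap (λ w → map (_∷ w) xs) vs)
    fresh a []         = []
    fresh a (v≢w ∷ hs) = All.++⁺ (All.map⁺ (All.universal (λ _ e → v≢w (∷-injectiveʳ e)) xs)) (fresh a hs)
    layers : {vs : List (Vec A n)} → Unique vs → Unique (concatMap (λ w → map (_∷ w) xs) vs)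
    layers {[]}     []         = []
    layers {v ∷ vs} (v∉ ∷ hs) = AllPairs.++⁺ (Unique.map⁺ ∷-injectiveˡ unique) (layers hs)
                                   (All.map⁺ (All.universal (λ a → fresh a v∉) xs))


module LinearForms where

  open import Data.Bool using (Bool; true; _∧_; T)
  open import Data.Nat as ℕ using (ℕ; suc; _^_; _≤_)
  import Data.Nat.Properties as ℕ
  open import Data.Integer using (ℤ; +_; _+_; _*_; _-_; _≟_; ≢-nonZero)
  import Data.Integer.Properties as ℤ
  open import Data.Integer.Tactic.RingSolver using (solve-∀)
  open import Data.List using (List; length; upTo)
  open import Data.List.Properties using (length-upTo)
  open import Data.List.Relation.Unary.All using (universal)
  open import Data.List.Relation.Unary.Unique.Propositional.Properties using (upTo⁺)
  open import Data.Product using (_,_; proj₁; proj₂)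
  open import Data.Sum using ([_,_]′)
  open import Relation.Nullary using (contradiction)
  open import Data.Vec using (Vec; []; _∷_)
  open import Data.Vec.Relation.Unary.Any using (Any; here; there)
  open import Relation.Binary.PropositionalEquality
  open import Relation.Nullary.Decidable using (toWitness; fromWitness)
  open import Algebra.Bundles using (AbelianGroup)
  open import Algebra.Properties.Group (AbelianGroup.group ℤ.+-0-abelianGroup) using (∙-cancelʳ)
  open import Defs using (allVecs; eqℤ)
  open Counting

  private variable
    n : ℕ

  eqℤ⇒≡ : ∀ {a b} → T (eqℤ a b) → a ≡ b
  eqℤ⇒≡ {a} {b} = toWitness {a? = a ≟ b}

  ≡⇒eqℤ : ∀ {a b} → a ≡ b → T (eqℤ a b)
  ≡⇒eqℤ {a} {b} = fromWitness {a? = a ≟ b}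

  box : ℕ → (n : ℕ) → List (Vec ℕ n)
  box M n = allVecs (upTo M) n

  length-box : ∀ M n → length (box M n) ≡ M ^ n
  length-box M n = trans (length-allVecs (upTo M) n) (cong (_^ n) (length-upTo M))

  dot : Vec ℤ n → Vec ℕ n → ℤ
  dot []       []       = + 0
  dot (a ∷ as) (x ∷ xs) = a * + x + dot as xs

  count-box-fibres : ∀ M (P : Vec ℕ (suc n) → Bool) (Q : Vec ℕ n → Bool) →
                     (∀ v → count (λ k → P (k ∷ v)) (upTo M) ≤ indicator (Q v)) →
                     count P (box M (suc n)) ≤ count Q (box M n)
  count-box-fibres {n} M P Q h = ℕ.≤-trans (ℕ.≤-reflexive (sumBy-allVecs (λ x → indicator (P x)) (upTo M))) (sumBy-mono (universal h (box M n)))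

  count-box-slices : ∀ M (P : Vec ℕ (suc n) → Bool) c →
                     (∀ k → count (λ v → P (k ∷ v)) (box M n) ℕ.* c ≤ M ^ n) →
                     count P (box M (suc n)) ℕ.* c ≤ M ^ suc n
  count-box-slices {n} M P c h = begin
    count P (box M (suc n)) ℕ.* c
      ≡⟨ cong (ℕ._* c) (trans (sumBy-allVecs (λ x → indicator (P x)) (upTo M)) (sumBy-swap _ (box M n) (upTo M))) ⟩
    sumBy (λ k → count (λ v → P (k ∷ v)) (box M n)) (upTo M) ℕ.* c
      ≡⟨ sumBy-*ʳ c _ (upTo M) ⟩
    sumBy (λ k → count (λ v → P (k ∷ v)) (box M n) ℕ.* c) (upTo M)
      ≤⟨ sumBy≤length* (universal h (upTo M)) ⟩
    length (upTo M) ℕ.* M ^ n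
      ≡⟨ cong (ℕ._* M ^ n) (length-upTo M) ⟩
    M ^ suc n ∎
    where open ℕ.≤-Reasoning

  count-box-fibres-bound : ∀ M (P : Vec ℕ (suc n) → Bool) (Q : Vec ℕ n → Bool) →
                           (∀ v → count (λ k → P (k ∷ v)) (upTo M) ≤ indicator (Q v)) →
                           count Q (box M n) ℕ.* M ≤ M ^ n →
                           count P (box M (suc n)) ℕ.* (M ℕ.* M) ≤ M ^ suc n
  count-box-fibres-bound {n} M P Q fibre hQ = begin
    count P (box M (suc n)) ℕ.* (M ℕ.* M) ≤⟨ ℕ.*-monoˡ-≤ (M ℕ.* M) (count-box-fibres M P Q fibre) ⟩
    count Q (box M n) ℕ.* (M ℕ.* M)       ≡⟨ ℕ.*-assoc (count Q (box M n)) M M ⟨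
    count Q (box M n) ℕ.* M ℕ.* M         ≤⟨ ℕ.*-monoˡ-≤ M hQ ⟩
    M ^ n ℕ.* M                           ≡⟨ ℕ.*-comm (M ^ n) M ⟩
    M ^ suc n                             ∎
    where open ℕ.≤-Reasoning

  count-affine≤1 : ∀ M {a} r α → a ≢ + 0 → count (λ k → eqℤ (a * + k + r) α) (upTo M) ≤ 1
  count-affine≤1 M {a} r α a≢0 = count-unique≤1 (upTo M) (upTo⁺ M) λ k k′ e e′ →
    ℤ.+-injective (ℤ.*-cancelˡ-≡ a (+ k) (+ k′) {{≢-nonZero a≢0}}
      (∙-cancelʳ r (a * + k) (a * + k′) (trans (eqℤ⇒≡ e) (sym (eqℤ⇒≡ e′)))))

  shift-eq : ∀ c r α → T (eqℤ (c + r) α) → T (eqℤ r (α - c))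
  shift-eq c r α e = ≡⇒eqℤ (trans (sym (lemma c r)) (cong (_- c) (eqℤ⇒≡ e)))
    where
    lemma : ∀ c r → (c + r) - c ≡ r
    lemma = solve-∀

  count-dot≡ : ∀ M {a : Vec ℤ n} → Any (_≢ + 0) a → ∀ α →
               count (λ x → eqℤ (dot a x) α) (box M n) ℕ.* M ≤ M ^ n
  count-dot≡ {suc n} M {a ∷ as} (here a≢0) α = begin
    count (λ x → eqℤ (dot (a ∷ as) x) α) (box M (suc n)) ℕ.* M
      ≤⟨ ℕ.*-monoˡ-≤ M (count-box-fibres M _ (λ _ → true) (λ v → count-affine≤1 M (dot as v) α a≢0)) ⟩
    count (λ _ → true) (box M n) ℕ.* M
      ≡⟨ cong (ℕ._* M) (trans (sumBy-const 1 (box M n)) (trans (ℕ.*-identityʳ _) (length-box M n))) ⟩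
    M ^ n ℕ.* M
      ≡⟨ ℕ.*-comm (M ^ n) M ⟩
    M ^ suc n ∎
    where open ℕ.≤-Reasoning
  count-dot≡ {suc n} M {a ∷ as} (there nz) α = count-box-slices {n} M _ M λ k →
    ℕ.≤-trans (ℕ.*-monoˡ-≤ M (count-mono (box M n) (λ v → shift-eq (a * + k) (dot as v) α)))
              (count-dot≡ M nz (α - a * + k))

  data Pivot : Vec ℤ n → Vec ℤ n → Set where
    here  : ∀ {a b as bs} → a ≢ + 0 → b ≡ + 0 → Pivot {suc n} (a ∷ as) (b ∷ bs)
    there : ∀ {a b as bs} → Pivot as bs → Pivot {suc n} (a ∷ as) (b ∷ bs)

  eliminate : ℤ → ℤ → Vec ℤ n → Vec ℤ n → Vec ℤ n
  eliminate a b []       []       = []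
  eliminate a b (c ∷ cs) (d ∷ ds) = (b * c - a * d) ∷ eliminate a b cs ds

  dot-eliminate : ∀ a b (as bs : Vec ℤ n) x → dot (eliminate a b as bs) x ≡ b * dot as x - a * dot bs x
  dot-eliminate a b []       []       []       = lemma a b
    where
    lemma : ∀ a b → + 0 ≡ b * + 0 - a * + 0
    lemma = solve-∀
  dot-eliminate a b (c ∷ cs) (d ∷ ds) (x ∷ xs) = begin
    (b * c - a * d) * + x + dot (eliminate a b cs ds) xs
      ≡⟨ cong (λ t → (b * c - a * d) * + x + t) (dot-eliminate a b cs ds xs) ⟩
    (b * c - a * d) * + x + (b * dot cs xs - a * dot ds xs)
      ≡⟨ lemma a b c d (+ x) (dot cs xs) (dot ds xs) ⟩
    b * (c * + x + dot cs xs) - a * (d * + x + dot ds xs) ∎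
    where
    open ≡-Reasoning
    lemma : ∀ a b c d x u v → (b * c - a * d) * x + (b * u - a * v) ≡ b * (c * x + u) - a * (d * x + v)
    lemma = solve-∀

  eliminate-pivot : ∀ a b {as bs : Vec ℤ n} → b ≢ + 0 → Pivot as bs → Any (_≢ + 0) (eliminate a b as bs)
  eliminate-pivot a b {c ∷ _} b≢0 (here c≢0 refl) = here λ e → [ b≢0 , c≢0 ]′ (ℤ.i*j≡0⇒i≡0∨j≡0 b (trans (sym (lemma a b c)) e))
    where
    lemma : ∀ a b c → b * c - a * + 0 ≡ b * c
    lemma = solve-∀
  eliminate-pivot a b         b≢0 (there p)  = there (eliminate-pivot a b b≢0 p)

  -- Peel off the first coordinate k: if one equation determines k, the other (after eliminating k)
  -- constrains the remaining coordinates alone; otherwise recurse on each slice k.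
  count-dot≡₂ : ∀ M {a b : Vec ℤ n} → Pivot a b → Any (_≢ + 0) b → ∀ α β →
                count (λ x → eqℤ (dot a x) α ∧ eqℤ (dot b x) β) (box M n) ℕ.* (M ℕ.* M) ≤ M ^ n
  count-dot≡₂ M (here a≢0 refl) (here 0≢0) α β = contradiction refl 0≢0
  count-dot≡₂ M {a ∷ as} {_ ∷ bs} (here a≢0 refl) (there nz) α β =
    count-box-fibres-bound M _ (λ v → eqℤ (dot bs v) β)
      (λ v → count≤indicator (upTo M) (λ k e → ≡⇒eqℤ (trans (sym (lemma (+ k) (dot bs v))) (eqℤ⇒≡ (proj₂ (∧⁻ e)))))
               (ℕ.≤-trans (count-mono (upTo M) (λ k e → proj₁ (∧⁻ e))) (count-affine≤1 M (dot as v) α a≢0)))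
      (count-dot≡ M nz β)
    where
    lemma : ∀ k r → + 0 * k + r ≡ r
    lemma = solve-∀
  count-dot≡₂ M {a ∷ as} {b ∷ bs} (there p) (here b≢0) α β =
    count-box-fibres-bound M _ (λ v → eqℤ (dot (eliminate a b as bs) v) (b * α - a * β))
      (λ v → count≤indicator (upTo M) (λ k e → let eα , eβ = ∧⁻ e in ≡⇒eqℤ (begin
                 dot (eliminate a b as bs) v                      ≡⟨ dot-eliminate a b as bs v ⟩
                 b * dot as v - a * dot bs v                      ≡⟨ lemma a b (+ k) (dot as v) (dot bs v) ⟨
                 b * (a * + k + dot as v) - a * (b * + k + dot bs v) ≡⟨ cong₂ (λ s t → b * s - a * t) (eqℤ⇒≡ eα) (eqℤ⇒≡ eβ) ⟩
                 b * α - a * β                                    ∎))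
               (ℕ.≤-trans (count-mono (upTo M) (λ k e → proj₂ (∧⁻ e))) (count-affine≤1 M (dot bs v) β b≢0)))
      (count-dot≡ M (eliminate-pivot a b b≢0 p) (b * α - a * β))
    where
    open ≡-Reasoning
    lemma : ∀ a b k u v → b * (a * k + u) - a * (b * k + v) ≡ b * u - a * v
    lemma = solve-∀
  count-dot≡₂ {suc n} M {a ∷ as} {b ∷ bs} (there p) (there nz) α β = count-box-slices {n} M _ (M ℕ.* M) λ k →
    ℕ.≤-trans (ℕ.*-monoˡ-≤ (M ℕ.* M) (count-mono (box M n) λ v e →
                 let eα , eβ = ∧⁻ e in ∧⁺ (shift-eq (a * + k) (dot as v) α eα) (shift-eq (b * + k) (dot bs v) β eβ)))
              (count-dot≡₂ M p nz (α - a * + k) (β - b * + k))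


module Signatures where

  open import Data.Bool using (Bool; true; false; if_then_else_; not; _∧_; T)
  open import Data.Nat as ℕ using (ℕ; _≤_)
  open import Data.Integer using (ℤ; +_; _+_; _*_; _-_; -_; _≟_)
  import Data.Integer.Properties as ℤ
  open import Data.Integer.Tactic.RingSolver using (solve-∀)
  open import Data.Product using (proj₁; proj₂)
  open import Data.Vec using (Vec; []; _∷_; map)
  open import Data.Vec.Membership.Propositional using (_∈_)
  open import Data.Vec.Relation.Unary.Any using (Any; here; there)
  open import Relation.Binary.PropositionalEquality
  open import Relation.Nullary using (yes; no; contradiction)
  open import Defs
  open Counting using (∧⁻)
  open LinearForms

  private variable
    n : ℕ

  dot-shift : ∀ z (S : Vec ℤ n) x → dot (map (_+ z) S) x ≡ sigS S x + z * + sumVec x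
  dot-shift z []       []       = lemma z
    where
    lemma : ∀ z → + 0 ≡ + 0 + z * + 0
    lemma = solve-∀
  dot-shift z (s ∷ S) (x ∷ xs) = begin
    (s + z) * + x + dot (map (_+ z) S) xs
      ≡⟨ cong (λ t → (s + z) * + x + t) (dot-shift z S xs) ⟩
    (s + z) * + x + (sigS S xs + z * + sumVec xs)
      ≡⟨ lemma s z (+ x) (sigS S xs) (+ sumVec xs) ⟩
    s * + x + sigS S xs + z * (+ x + + sumVec xs)
      ≡⟨ cong (λ t → s * + x + sigS S xs + z * t) (ℤ.pos-+ x (sumVec xs)) ⟨
    s * + x + sigS S xs + z * + sumVec (x ∷ xs) ∎
    where
    open ≡-Reasoning
    lemma : ∀ s z x u v → (s + z) * x + (u + z * v) ≡ s * x + u + z * (x + v)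
    lemma = solve-∀

  solution⇒dot≡ : ∀ D σ τ z (x : Vec ℕ n) S → T (isSolution D σ τ z x S) → T (eqℤ (dot (map (_+ z) S) x) τ)
  solution⇒dot≡ D σ τ z x S h = ≡⇒eqℤ (begin
    dot (map (_+ z) S) x                     ≡⟨ dot-shift z S x ⟩
    sigS S x + z * + sumVec x                ≡⟨ cong (_+ z * + sumVec x) (eqℤ⇒≡ (proj₂ (∧⁻ {corresponds D σ S} h))) ⟩
    τ - z * + sumVec x + z * + sumVec x      ≡⟨ lemma τ (z * + sumVec x) ⟩
    τ                                        ∎)
    where
    open ≡-Reasoning
    lemma : ∀ t u → t - u + u ≡ t
    lemma = solve-∀

  select : Bool → ℤ → ℤ
  select b s = if b then s else + 0

  halfDiff : Vec ℤ n → Vec Bool n → Vec Bool n → Vec ℤ n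
  halfDiff []       []       []        = []
  halfDiff (s ∷ S) (b ∷ h) (b′ ∷ h′) = (select b s - select b′ s) ∷ halfDiff S h h′

  dot-halfDiff : ∀ (S : Vec ℤ n) h h′ x → dot (halfDiff S h h′) x ≡ sigT S h x - sigT S h′ x
  dot-halfDiff []       []       []        []       = refl
  dot-halfDiff (s ∷ S) (b ∷ h) (b′ ∷ h′) (x ∷ xs) = begin
    (select b s - select b′ s) * + x + dot (halfDiff S h h′) xs
      ≡⟨ cong (λ t → (select b s - select b′ s) * + x + t) (dot-halfDiff S h h′ xs) ⟩
    (select b s - select b′ s) * + x + (sigT S h xs - sigT S h′ xs)
      ≡⟨ lemma (select b s) (select b′ s) (+ x) (sigT S h xs) (sigT S h′ xs) ⟩
    select b s * + x + sigT S h xs - (select b′ s * + x + sigT S h′ xs)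
      ≡⟨ cong₂ (λ u v → u + sigT S h xs - (v + sigT S h′ xs)) (select-* b) (select-* b′) ⟩
    sigT (s ∷ S) (b ∷ h) (x ∷ xs) - sigT (s ∷ S) (b′ ∷ h′) (x ∷ xs) ∎
    where
    open ≡-Reasoning
    lemma : ∀ p q x u v → (p - q) * x + (u - v) ≡ p * x + u - (q * x + v)
    lemma = solve-∀
    select-* : ∀ b → select b s * + x ≡ (if b then s * + x else + 0)
    select-* true  = refl
    select-* false = refl

  collision⇒dot≡0 : ∀ (S : Vec ℤ n) h h′ x → T (eqℤ (sigT S h x) (sigT S h′ x)) → T (eqℤ (dot (halfDiff S h h′) x) (+ 0))
  collision⇒dot≡0 S h h′ x e =
    ≡⇒eqℤ (trans (dot-halfDiff S h h′ x) (trans (cong (_- sigT S h′ x) (eqℤ⇒≡ e)) (ℤ.+-inverseʳ (sigT S h′ x))))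

  countLabel⇒∈ : ∀ w (S : Vec ℤ n) → 1 ≤ countLabel w S → w ∈ S
  countLabel⇒∈ w (s ∷ S) h with s ≟ w
  ... | yes refl = here refl
  ... | no _     = there (countLabel⇒∈ w S h)

  shift-halfDiff-pivot : ∀ {z} → z ≢ + 0 → {S : Vec ℤ n} → + 0 ∈ S → ∀ h h′ → Pivot (map (_+ z) S) (halfDiff S h h′)
  shift-halfDiff-pivot {z = z} z≢0 (here refl) (b ∷ _) (b′ ∷ _) =
    here (λ e → z≢0 (trans (sym (ℤ.+-identityˡ z)) e)) (cong₂ _-_ (select-0 b) (select-0 b′))
    where
    select-0 : ∀ b → select b (+ 0) ≡ + 0
    select-0 true  = refl
    select-0 false = refl
  shift-halfDiff-pivot z≢0 (there 0∈S) (_ ∷ h) (_ ∷ h′) = there (shift-halfDiff-pivot z≢0 0∈S h h′)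

  avoidsZero-head : ∀ s (S : Vec ℤ n) h → T (avoidsZero (s ∷ S) (true ∷ h)) → s ≢ + 0
  avoidsZero-head _ S h a refl = proj₁ (∧⁻ {false} {avoidsZero S h} a)

  avoidsZero-tail : ∀ s (S : Vec ℤ n) b h → T (avoidsZero (s ∷ S) (b ∷ h)) → T (avoidsZero S h)
  avoidsZero-tail s S b h a = proj₂ (∧⁻ {not (eqℤ s (+ 0) ∧ b)} a)

  halfDiff-nonzero : ∀ (S : Vec ℤ n) {h h′} → h ≢ h′ → T (avoidsZero S h) → T (avoidsZero S h′) →
                     Any (_≢ + 0) (halfDiff S h h′)
  halfDiff-nonzero []      {[]}        {[]}         h≢h′ _ _  = contradiction refl h≢h′
  halfDiff-nonzero (s ∷ S) {true ∷ h}  {false ∷ _}  _    a _  =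
    here (λ e → avoidsZero-head s S h a (trans (sym (ℤ.+-identityʳ s)) e))
  halfDiff-nonzero (s ∷ S) {false ∷ _} {true ∷ h′}  _    _ a′ =
    here (λ e → avoidsZero-head s S h′ a′ (trans (sym (ℤ.neg-involutive s)) (cong -_ (trans (sym (ℤ.+-identityˡ (- s))) e))))
  halfDiff-nonzero (s ∷ S) {true ∷ h}  {true ∷ h′}  h≢h′ a a′ =
    there (halfDiff-nonzero S (λ e → h≢h′ (cong (true ∷_) e)) (avoidsZero-tail s S true h a) (avoidsZero-tail s S true h′ a′))
  halfDiff-nonzero (s ∷ S) {false ∷ h} {false ∷ h′} h≢h′ a a′ =
    there (halfDiff-nonzero S (λ e → h≢h′ (cong (false ∷_) e)) (avoidsZero-tail s S false h a) (avoidsZero-tail s S false h′ a′))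


module Collisions where

  open import Data.Bool using (true; false)
  open import Data.Nat using (ℕ; suc; _+_; _*_; _≤_; z≤n; s≤s)
  open import Data.Nat.Properties hiding (_≟_)
  open import Data.Integer using (ℤ; _≟_)
  open import Data.List using (List; []; _∷_; length; map; _++_; filter; deduplicate)
  open import Data.List.Properties using (length-++; length-map)
  open import Data.List.Relation.Unary.All as All using (All; []; _∷_)
  import Data.List.Relation.Unary.All.Properties as All
  open import Data.List.Relation.Unary.AllPairs using ([]; _∷_)
  open import Data.List.Relation.Unary.Unique.Propositional using (Unique)
  open import Data.Product using (_×_; _,_; proj₁; proj₂)
  open import Function using (_∘_)
  open import Relation.Binary.PropositionalEquality
  open import Relation.Nullary using (does; yes; no; ¬?)
  open import Relation.Unary using (Decidable)
  open import Defs using (eqℤ)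
  open Counting

  private variable
    A : Set

  pairs : List A → List (A × A)
  pairs []       = []
  pairs (x ∷ xs) = map (x ,_) xs ++ pairs xs

  length-pairs : (xs : List A) → length (pairs xs) ≤ length xs * length xs
  length-pairs []       = z≤n
  length-pairs (x ∷ xs) = begin
    length (map (x ,_) xs ++ pairs xs)   ≡⟨ trans (length-++ (map (x ,_) xs)) (cong (_+ length (pairs xs)) (length-map (x ,_) xs)) ⟩
    length xs + length (pairs xs)        ≤⟨ +-monoʳ-≤ (length xs) (length-pairs xs) ⟩
    length xs + length xs * length xs    ≡⟨ *-suc (length xs) (length xs) ⟨
    length xs * suc (length xs)          ≤⟨ *-monoˡ-≤ (suc (length xs)) (n≤1+n (length xs)) ⟩
    suc (length xs) * suc (length xs)    ∎
    where open ≤-Reasoning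

  pairs-All : {P : A → Set} {xs : List A} → Unique xs → All P xs →
              All (λ uv → proj₁ uv ≢ proj₂ uv × P (proj₁ uv) × P (proj₂ uv)) (pairs xs)
  pairs-All {xs = []}    []          []         = []
  pairs-All {xs = x ∷ _} (x∉xs ∷ u) (px ∷ pxs) =
    All.++⁺ (All.map⁺ (All.zipWith (λ (x≢y , py) → x≢y , px , py) (x∉xs , pxs))) (pairs-All u pxs)

  length≤filter-≢+count : ∀ y (xs : List ℤ) → length xs ≤ length (filter (¬? ∘ (y ≟_)) xs) + count (eqℤ y) xs
  length≤filter-≢+count y []       = z≤n
  length≤filter-≢+count y (x ∷ xs) with y ≟ x
  ... | yes _ = ≤-trans (s≤s (length≤filter-≢+count y xs)) (≤-reflexive (sym (+-suc _ _)))
  ... | no _  = s≤s (length≤filter-≢+count y xs)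

  count-filter≤ : {P : A → Set} (P? : Decidable P) (q : A → _) (xs : List A) → count q (filter P? xs) ≤ count q xs
  count-filter≤ P? q []       = z≤n
  count-filter≤ P? q (x ∷ xs) with does (P? x)
  ... | true  = +-monoʳ-≤ (indicator (q x)) (count-filter≤ P? q xs)
  ... | false = m≤n⇒m≤o+n (indicator (q x)) (count-filter≤ P? q xs)

  count-deduplicate≤ : ∀ q (xs : List ℤ) → count q (deduplicate _≟_ xs) ≤ count q xs
  count-deduplicate≤ q []       = z≤n
  count-deduplicate≤ q (x ∷ xs) =
    +-monoʳ-≤ (indicator (q x)) (≤-trans (count-filter≤ _ q (deduplicate _≟_ xs)) (count-deduplicate≤ q xs))

  collisions : (A → ℤ) → List A → ℕ
  collisions f xs = count (λ uv → eqℤ (f (proj₁ uv)) (f (proj₂ uv))) (pairs xs)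

  length≤distinct+collisions : (f : A → ℤ) (xs : List A) →
                               length xs ≤ length (deduplicate _≟_ (map f xs)) + collisions f xs
  length≤distinct+collisions f []       = z≤n
  length≤distinct+collisions f (x ∷ xs) = s≤s (begin
    length xs
      ≤⟨ length≤distinct+collisions f xs ⟩
    length ys + collisions f xs
      ≤⟨ +-monoˡ-≤ (collisions f xs) (length≤filter-≢+count (f x) ys) ⟩
    others + count (eqℤ (f x)) ys + collisions f xs
      ≤⟨ +-monoˡ-≤ (collisions f xs) (+-monoʳ-≤ others (count-deduplicate≤ (eqℤ (f x)) (map f xs))) ⟩
    others + count (eqℤ (f x)) (map f xs) + collisions f xs
      ≡⟨ +-assoc others _ _ ⟩
    others + (count (eqℤ (f x)) (map f xs) + collisions f xs)
      ≡⟨ cong (λ t → others + (t + collisions f xs)) (trans (sumBy-map _ f xs) (sym (sumBy-map _ (x ,_) xs))) ⟩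
    others + (count _ (map (x ,_) xs) + collisions f xs)
      ≡⟨ cong (others +_) (sym (sumBy-++ _ (map (x ,_) xs) (pairs xs))) ⟩
    others + collisions f (x ∷ xs) ∎)
    where
    open ≤-Reasoning
    ys : List ℤ
    ys = deduplicate _≟_ (map f xs)
    others : ℕ
    others = length (filter (¬? ∘ (f x ≟_)) ys)


module PerPartition where

  open import Data.Bool using (Bool; true; false; _∧_; not; T)
  open import Data.Nat using (ℕ; zero; suc; _+_; _*_; _^_; _≤_; _<_; z≤n; _≤ᵇ_)
  open import Data.Nat.Properties
  open import Data.Nat.Tactic.RingSolver using (solve-∀)
  open import Algebra.Properties.CommutativeSemigroup *-commutativeSemigroup using (xy∙z≈xz∙y)
  open import Data.Integer using (ℤ; +_)
  open import Data.List using (List; []; _∷_; length)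
  open import Data.List.Relation.Unary.AllPairs using ([]; _∷_)
  open import Data.List.Relation.Unary.Unique.Propositional using (Unique)
  open import Data.List.Relation.Unary.All as All using (All; []; _∷_)
  import Data.List.Relation.Unary.All.Properties as All
  import Data.List.Relation.Unary.AllPairs.Properties as AllPairs
  open import Data.Product using (_×_; _,_; proj₁; proj₂)
  open import Data.Vec using (Vec; map)
  open import Data.Vec.Membership.Propositional using (_∈_)
  open import Function using (_∘_)
  open import Relation.Binary.PropositionalEquality
  open import Relation.Nullary.Decidable using (T?)
  open import Relation.Nullary.Reflects using (ofⁿ)
  open import Defs
  open Counting
  open LinearForms
  open Signatures
  open Collisions

  private variable
    n : ℕ

  bools : List Bool
  bools = true ∷ false ∷ []

  bools-unique : Unique bools
  bools-unique = ((λ ()) ∷ []) ∷ [] ∷ []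

  poorSolution : List ℤ → (ℤ → ℕ) → ℤ → ℤ → Vec ℕ n → Vec ℤ n → Bool
  poorSolution D σ τ z x S = isSolution D σ τ z x S ∧ not (manySigs D 1 2 x S)

  *-cancelʳ-≤′ : ∀ m n o → (o ≡ 0 → m ≡ 0) → m * o ≤ n * o → m ≤ n
  *-cancelʳ-≤′ m n zero    m≡0 _ = ≤-trans (≤-reflexive (m≡0 refl)) z≤n
  *-cancelʳ-≤′ m n (suc o) _   h = *-cancelʳ-≤ m n (suc o) h

  ≤ᵇ-false⇒> : ∀ m n → T (not (m ≤ᵇ n)) → n < m
  ≤ᵇ-false⇒> m n h with m ≤ᵇ n | ≤ᵇ-reflects-≤ m n
  ... | false | ofⁿ m≰n = ≰⇒> m≰n

  ≤-twice-collisions : ∀ a d c → 2 * d < a → a ≤ d + c → a ≤ 2 * c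
  ≤-twice-collisions a d c 2d<a a≤d+c = <⇒≤ (+-cancelˡ-< a a (2 * c) (begin-strict
    a + a             ≤⟨ +-mono-≤ a≤d+c a≤d+c ⟩
    d + c + (d + c)   ≡⟨ lemma d c ⟩
    2 * d + 2 * c     <⟨ +-monoˡ-< (2 * c) 2d<a ⟩
    a + 2 * c         ∎))
    where
    open ≤-Reasoning
    lemma : ∀ d c → d + c + (d + c) ≡ 2 * d + 2 * c
    lemma = solve-∀

  module _ (D : List ℤ) (σ : ℤ → ℕ) (τ z : ℤ) (M : ℕ) {n : ℕ} (S : Vec ℤ n) where

    private
      halves : List (Vec Bool n)
      halves = halfPartitions D S
      a : ℕ
      a = numHalf D S
      X : List (Vec ℕ n)
      X = box M n

    collidingSolution : Vec Bool n × Vec Bool n → Vec ℕ n → Bool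
    collidingSolution (h , h′) x = isSolution D σ τ z x S ∧ eqℤ (sigT S h x) (sigT S h′ x)

    fewSignatures : ∀ x → T (not (manySigs D 1 2 x S)) → 2 * distinctSigs D S x < a
    fewSignatures x h = subst (2 * distinctSigs D S x <_) (*-identityˡ a) (≤ᵇ-false⇒> (1 * a) (2 * distinctSigs D S x) h)

    poor⇒many-collisions : ∀ x → indicator (poorSolution D σ τ z x S) * a ≤ 2 * count (λ pr → collidingSolution pr x) (pairs halves)
    poor⇒many-collisions x with isSolution D σ τ z x S | manySigs D 1 2 x S in many
    ... | false | _     = z≤n
    ... | true  | true  = z≤n
    ... | true  | false = ≤-trans (≤-reflexive (+-identityʳ a))
            (≤-twice-collisions a (distinctSigs D S x) _ (fewSignatures x (subst (T ∘ not) (sym many) _))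
                                (length≤distinct+collisions (λ h → sigT S h x) halves))

    count-poor*a≤ : count (λ x → poorSolution D σ τ z x S) X * a ≤ 2 * sumBy (λ pr → count (collidingSolution pr) X) (pairs halves)
    count-poor*a≤ = begin
      count (λ x → poorSolution D σ τ z x S) X * a
        ≡⟨ sumBy-*ʳ a _ X ⟩
      sumBy (λ x → indicator (poorSolution D σ τ z x S) * a) X
        ≤⟨ sumBy-mono (All.universal poor⇒many-collisions X) ⟩
      sumBy (λ x → 2 * count (λ pr → collidingSolution pr x) (pairs halves)) X
        ≡⟨ sumBy-*ˡ 2 _ X ⟩
      2 * sumBy (λ x → count (λ pr → collidingSolution pr x) (pairs halves)) X
        ≡⟨ cong (2 *_) (sumBy-swap (λ x pr → indicator (collidingSolution pr x)) X (pairs halves)) ⟩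
      2 * sumBy (λ pr → count (collidingSolution pr) X) (pairs halves) ∎
      where open ≤-Reasoning

    count-collidingSolution : z ≢ + 0 → + 0 ∈ S → ∀ {h h′} → h ≢ h′ → T (avoidsZero S h) → T (avoidsZero S h′) →
                              count (collidingSolution (h , h′)) X * (M * M) ≤ M ^ n
    count-collidingSolution z≢0 0∈S {h} {h′} h≢h′ a a′ = ≤-trans
      (*-monoˡ-≤ (M * M) (count-mono X λ x e → let sol , coll = ∧⁻ {isSolution D σ τ z x S} e in
        ∧⁺ (solution⇒dot≡ D σ τ z x S sol) (collision⇒dot≡0 S h h′ x coll)))
      (count-dot≡₂ M (shift-halfDiff-pivot z≢0 0∈S h h′) (halfDiff-nonzero S h≢h′ a a′) τ (+ 0))

    halves-pairs : All (λ pr → proj₁ pr ≢ proj₂ pr × T (avoidsZero S (proj₁ pr)) × T (avoidsZero S (proj₂ pr))) (pairs halves)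
    halves-pairs = pairs-All (AllPairs.filter⁺ (T? ∘ isHalfPartition D S) (allVecs⁺ bools-unique n))
      (All.map (λ {h} e → proj₁ (∧⁻ {avoidsZero S h} e)) (All.all-filter (T? ∘ isHalfPartition D S) (allVecs bools n)))

    count-poorSolution : z ≢ + 0 → + 0 ∈ S → count (λ x → poorSolution D σ τ z x S) X * (M * M) ≤ 2 * a * M ^ n
    count-poorSolution z≢0 0∈S = *-cancelʳ-≤′ _ _ a none (begin
      count (λ x → poorSolution D σ τ z x S) X * (M * M) * a
        ≡⟨ xy∙z≈xz∙y (count (λ x → poorSolution D σ τ z x S) X) (M * M) a ⟩
      count (λ x → poorSolution D σ τ z x S) X * a * (M * M)
        ≤⟨ *-monoˡ-≤ (M * M) count-poor*a≤ ⟩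
      2 * sumBy (λ pr → count (collidingSolution pr) X) (pairs halves) * (M * M)
        ≡⟨ *-assoc 2 (sumBy (λ pr → count (collidingSolution pr) X) (pairs halves)) (M * M) ⟩
      2 * (sumBy (λ pr → count (collidingSolution pr) X) (pairs halves) * (M * M))
        ≡⟨ cong (2 *_) (sumBy-*ʳ (M * M) _ (pairs halves)) ⟩
      2 * sumBy (λ pr → count (collidingSolution pr) X * (M * M)) (pairs halves)
        ≤⟨ *-monoʳ-≤ 2 (sumBy≤length* (All.map (λ (h≢h′ , a , a′) → count-collidingSolution z≢0 0∈S h≢h′ a a′) halves-pairs)) ⟩
      2 * (length (pairs halves) * M ^ n)
        ≤⟨ *-monoʳ-≤ 2 (*-monoˡ-≤ (M ^ n) (length-pairs halves)) ⟩
      2 * (a * a * M ^ n)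
        ≡⟨ lemma a (M ^ n) ⟩
      2 * a * M ^ n * a ∎)
      where
      open ≤-Reasoning
      lemma : ∀ a m → 2 * (a * a * m) ≡ 2 * a * m * a
      lemma = solve-∀
      none : a ≡ 0 → count (λ x → poorSolution D σ τ z x S) X * (M * M) ≡ 0
      none a≡0 = cong (_* (M * M)) (count-none (All.universal (λ x poor →
        <⇒≱ (fewSignatures x (proj₂ (∧⁻ {isSolution D σ τ z x S} poor))) (≤-trans (≤-reflexive a≡0) z≤n)) X))


module Summation where

  open import Data.Bool using (Bool; true; false; _∧_; _∨_; not; T)
  open import Data.Bool.ListAction using (any)
  open import Data.Nat using (ℕ; zero; suc; _+_; _*_; _^_; _≤_; _<_; z≤n; s≤s; _≡ᵇ_)
  open import Data.Nat.Properties
  open import Data.Nat.Tactic.RingSolver using (solve-∀)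
  open import Data.Integer using (ℤ; +_)
  open import Data.List using (List; []; _∷_; length)
  open import Data.List.Membership.Propositional using (_∈_)
  open import Data.Vec.Membership.Propositional using () renaming (_∈_ to _∈ᵥ_)
  open import Data.List.Relation.Unary.All as All using (All)
  import Data.List.Relation.Unary.All.Properties as All
  open import Data.List.Relation.Unary.Any using (here; there)
  open import Data.Product using (proj₁)
  open import Data.Vec using (Vec; _∷_)
  open import Function using (_∘_)
  open import Relation.Nullary using (yes; no)
  open import Relation.Nullary.Decidable using (T?)
  open import Relation.Binary.PropositionalEquality
  open import Defs
  open Counting
  open LinearForms
  open Signatures
  open PerPartition

  private variable
    A B : Set
    n : ℕ

  avoidingHalves : Vec ℤ n → ℕ
  avoidingHalves {n} S = count (avoidsZero S) (allVecs bools n)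

  numHalf≤avoidingHalves : ∀ D (S : Vec ℤ n) → numHalf D S ≤ avoidingHalves S
  numHalf≤avoidingHalves {n} D S = subst (_≤ avoidingHalves S) (sym (length-filterᵇ (isHalfPartition D S) (allVecs bools n)))
    (count-mono (allVecs bools n) (λ h e → proj₁ (∧⁻ {avoidsZero S h} e)))

  weight : ℤ → ℕ
  weight w = indicator (not (eqℤ w (+ 0))) + 1

  avoidingHalves-∷ : ∀ s (S : Vec ℤ n) → avoidingHalves (s ∷ S) ≡ weight s * avoidingHalves S
  avoidingHalves-∷ {n} s S = trans (sumBy-allVecs (λ h → indicator (avoidsZero (s ∷ S) h)) bools)
    (trans (sumBy-cong (allVecs bools n) (λ h → head-choices (eqℤ s (+ 0)) (avoidsZero S h)))
           (sumBy-*ˡ (weight s) _ (allVecs bools n)))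
    where
    head-choices : ∀ e q → indicator (not (e ∧ true) ∧ q) + (indicator (not (e ∧ false) ∧ q) + 0)
                           ≡ (indicator (not e) + 1) * indicator q
    head-choices true  true  = refl
    head-choices true  false = refl
    head-choices false true  = refl
    head-choices false false = refl

  sumBy-avoidingHalves : ∀ (D : List ℤ) n → sumBy avoidingHalves (allVecs D n) ≡ sumBy weight D ^ n
  sumBy-avoidingHalves D zero    = refl
  sumBy-avoidingHalves D (suc n) = begin
    sumBy avoidingHalves (allVecs D (suc n))
      ≡⟨ sumBy-allVecs {n = n} avoidingHalves D ⟩
    sumBy (λ S → sumBy (λ s → avoidingHalves (s ∷ S)) D) (allVecs D n)
      ≡⟨ sumBy-cong (allVecs D n) (λ S → trans (sumBy-cong D (λ s → trans (avoidingHalves-∷ s S) (*-comm (weight s) _)))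
                                                (trans (sumBy-*ˡ (avoidingHalves S) weight D) (*-comm (avoidingHalves S) _))) ⟩
    sumBy (λ S → sumBy weight D * avoidingHalves S) (allVecs D n)
      ≡⟨ sumBy-*ˡ (sumBy weight D) avoidingHalves (allVecs D n) ⟩
    sumBy weight D * sumBy avoidingHalves (allVecs D n)
      ≡⟨ cong (sumBy weight D *_) (sumBy-avoidingHalves D n) ⟩
    sumBy weight D ^ suc n ∎
    where open ≡-Reasoning

  weight≤2 : ∀ w → weight w ≤ 2
  weight≤2 w with not (eqℤ w (+ 0))
  ... | true  = ≤-refl
  ... | false = s≤s z≤n

  sumBy-weight< : {D : List ℤ} → + 0 ∈ D → sumBy weight D < 2 * length D
  sumBy-weight< {_ ∷ D} (here refl) = begin-strict
    1 + sumBy weight D     <⟨ s≤s (+-monoʳ-≤ 1 (sumBy≤length* (All.universal weight≤2 D))) ⟩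
    2 + length D * 2       ≡⟨ cong (λ t → 2 + t) (*-comm (length D) 2) ⟩
    2 + 2 * length D       ≡⟨ *-suc 2 (length D) ⟨
    2 * suc (length D)     ∎
    where open ≤-Reasoning
  sumBy-weight< {w ∷ D} (there 0∈D) = begin-strict
    weight w + sumBy weight D   <⟨ +-mono-≤-< (weight≤2 w) (sumBy-weight< 0∈D) ⟩
    2 + 2 * length D            ≡⟨ *-suc 2 (length D) ⟨
    2 * suc (length D)          ∎
    where open ≤-Reasoning

  any-∧-not : (p q : A → Bool) (xs : List A) →
              T (any p xs ∧ not (any (λ x → p x ∧ q x) xs)) → T (any (λ x → p x ∧ not (q x)) xs)
  any-∧-not p q (x ∷ xs) h with p x | q x
  ... | true  | false = _
  ... | false | _     = any-∧-not p q xs h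

  count-any≤ : (R : A → B → Bool) (ys : List B) (xs : List A) →
               count (λ x → any (R x) ys) xs ≤ sumBy (λ y → count (λ x → R x y) xs) ys
  count-any≤ R []       xs = ≤-reflexive (trans (sumBy-const 0 xs) (*-zeroʳ (length xs)))
  count-any≤ R (y ∷ ys) xs = begin
    sumBy (λ x → indicator (R x y ∨ any (R x) ys)) xs
      ≤⟨ sumBy-mono (All.universal (λ x → indicator-∨ (R x y) _) xs) ⟩
    sumBy (λ x → indicator (R x y) + indicator (any (R x) ys)) xs
      ≡⟨ sumBy-+ _ _ xs ⟩
    count (λ x → R x y) xs + count (λ x → any (R x) ys) xs
      ≤⟨ +-monoʳ-≤ (count (λ x → R x y) xs) (count-any≤ R ys xs) ⟩
    count (λ x → R x y) xs + sumBy (λ y → count (λ x → R x y) xs) ys ∎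
    where
    open ≤-Reasoning
    indicator-∨ : ∀ a b → indicator (a ∨ b) ≤ indicator a + indicator b
    indicator-∨ true  b = s≤s z≤n
    indicator-∨ false b = ≤-refl

  module _ (D : List ℤ) (σ : ℤ → ℕ) (τ z : ℤ) (n M : ℕ) (0∈D : + 0 ∈ D) (σ₀>0 : 1 ≤ σ (+ 0)) (z≢0 : z ≢ + 0) where

    private
      X : List (Vec ℕ n)
      X = box M n

    poor⇒corresponds : ∀ {S : Vec ℤ n} x → T (poorSolution D σ τ z x S) → T (corresponds D σ S)
    poor⇒corresponds {S} x poor =
      proj₁ (∧⁻ {corresponds D σ S} (proj₁ (∧⁻ {isSolution D σ τ z x S} {not (manySigs D 1 2 x S)} poor)))

    count-poorSolution≤ : ∀ (S : Vec ℤ n) → count (λ x → poorSolution D σ τ z x S) X * (M * M) ≤ 2 * avoidingHalves S * M ^ n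
    count-poorSolution≤ S with T? (corresponds D σ S)
    ... | no ¬corr = ≤-trans (≤-reflexive (cong (_* (M * M)) (count-none (All.universal (λ x → ¬corr ∘ poor⇒corresponds {S} x) X)))) z≤n
    ... | yes corr = ≤-trans (count-poorSolution D σ τ z M S z≢0 0∈S)
                             (*-monoˡ-≤ (M ^ n) (*-monoʳ-≤ 2 (numHalf≤avoidingHalves D S)))
      where
      countLabel-0 : countLabel (+ 0) S ≡ σ (+ 0)
      countLabel-0 = ≡ᵇ⇒≡ _ _ (All.lookup (All.all⁺ (λ w → countLabel w S ≡ᵇ σ w) D corr) 0∈D)
      0∈S : + 0 ∈ᵥ S
      0∈S = countLabel⇒∈ (+ 0) S (subst (1 ≤_) (sym countLabel-0) σ₀>0)

    badCount-bound : badCount D σ τ z 1 2 n M * (M * M) ≤ 2 * sumBy weight D ^ n * M ^ n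
    badCount-bound = begin
      badCount D σ τ z 1 2 n M * (M * M)
        ≡⟨ cong (_* (M * M)) (length-filterᵇ _ X) ⟩
      count (badInput D σ τ z 1 2) X * (M * M)
        ≤⟨ *-monoˡ-≤ (M * M) (≤-trans (count-mono X (λ x → any-∧-not (isSolution D σ τ z x) (manySigs D 1 2 x) (allPartitions D n)))
                                      (count-any≤ (λ x S → poorSolution D σ τ z x S) (allVecs D n) X)) ⟩
      sumBy (λ S → count (λ x → poorSolution D σ τ z x S) X) (allVecs D n) * (M * M)
        ≡⟨ sumBy-*ʳ (M * M) _ (allVecs D n) ⟩
      sumBy (λ S → count (λ x → poorSolution D σ τ z x S) X * (M * M)) (allVecs D n)
        ≤⟨ sumBy-mono (All.universal count-poorSolution≤ (allVecs D n)) ⟩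
      sumBy (λ S → 2 * avoidingHalves S * M ^ n) (allVecs D n)
        ≡⟨ sumBy-cong (allVecs D n) (λ S → lemma (avoidingHalves S) (M ^ n)) ⟩
      sumBy (λ S → 2 * M ^ n * avoidingHalves S) (allVecs D n)
        ≡⟨ sumBy-*ˡ (2 * M ^ n) avoidingHalves (allVecs D n) ⟩
      2 * M ^ n * sumBy avoidingHalves (allVecs D n)
        ≡⟨ cong (2 * M ^ n *_) (sumBy-avoidingHalves D n) ⟩
      2 * M ^ n * sumBy weight D ^ n
        ≡⟨ lemma (sumBy weight D ^ n) (M ^ n) ⟨
      2 * sumBy weight D ^ n * M ^ n ∎
      where
      open ≤-Reasoning
      lemma : ∀ a m → 2 * a * m ≡ 2 * m * a
      lemma = solve-∀


module Exponents where

  open import Data.Nat using (ℕ; zero; suc; _+_; _*_; _^_; _≤_; _<_; _∸_; NonZero; >-nonZero)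
  open import Data.Nat.Properties
  open import Data.Nat.Tactic.RingSolver using (solve-∀)
  open import Data.Sum using (inj₁; inj₂)
  open import Relation.Binary.PropositionalEquality
  open import Relation.Nullary using (contradiction)

  ^-distribʳ-* : ∀ a b k → (a * b) ^ k ≡ a ^ k * b ^ k
  ^-distribʳ-* a b zero    = refl
  ^-distribʳ-* a b (suc k) = trans (cong (a * b *_) (^-distribʳ-* a b k)) (lemma a b (a ^ k) (b ^ k))
    where
    lemma : ∀ a b x y → a * b * (x * y) ≡ a * x * (b * y)
    lemma = solve-∀

  ^-comm : ∀ u a b → (u ^ a) ^ b ≡ (u ^ b) ^ a
  ^-comm u a b = trans (^-*-assoc u a b) (trans (cong (u ^_) (*-comm a b)) (sym (^-*-assoc u b a)))

  ^-cancelʳ-≤ : ∀ k {u v} → 1 ≤ k → u ^ k ≤ v ^ k → u ≤ v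
  ^-cancelʳ-≤ (suc k) {u} {v} _ uᵏ≤vᵏ with ≤-<-connex u v
  ... | inj₁ u≤v = u≤v
  ... | inj₂ v<u = contradiction uᵏ≤vᵏ (<⇒≱ (^-monoˡ-< (suc k) v<u))

  ^-positive : ∀ {c} k → 1 ≤ c → 1 ≤ c ^ k
  ^-positive zero    _   = ≤-refl
  ^-positive (suc k) 1≤c = *-mono-≤ 1≤c (^-positive k 1≤c)

  -- Bernoulli's inequality (1 + 1/m)^k ≥ 1 + k/m, cleared of denominators.
  bernoulli : ∀ m k → m ^ k * (m + k) ≤ suc m ^ k * m
  bernoulli m zero    = ≤-reflexive (cong (_+ 0) (+-identityʳ m))
  bernoulli m (suc k) = begin
    m * m ^ k * (m + suc k)             ≡⟨ lemma₁ m (m ^ k) k ⟩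
    m * (m ^ k * (m + k)) + m * m ^ k   ≤⟨ +-mono-≤ (*-monoʳ-≤ m (bernoulli m k)) (*-monoʳ-≤ m (^-monoˡ-≤ k (n≤1+n m))) ⟩
    m * (suc m ^ k * m) + m * suc m ^ k ≡⟨ lemma₂ m (suc m ^ k) ⟩
    suc m * suc m ^ k * m               ∎
    where
    open ≤-Reasoning
    lemma₁ : ∀ m x k → m * x * (m + suc k) ≡ m * (x * (m + k)) + m * x
    lemma₁ = solve-∀
    lemma₂ : ∀ m x → m * (x * m) + m * x ≡ suc m * x * m
    lemma₂ = solve-∀

  bernoulli-power : ∀ m H x y → 1 ≤ m → suc m * y ≤ m * x → H * y ^ (m * H) ≤ x ^ (m * H)
  bernoulli-power m H x y 1≤m hyp = *-cancelˡ-≤ m {{m≢0}} (*-cancelˡ-≤ (m ^ k) {{m^n≢0 m k {{m≢0}}}} (begin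
    m ^ k * (m * (H * y ^ k))    ≤⟨ *-monoʳ-≤ (m ^ k) (≤-trans (≤-reflexive (sym (*-assoc m H (y ^ k)))) (*-monoˡ-≤ (y ^ k) (m≤n+m k m))) ⟩
    m ^ k * ((m + k) * y ^ k)    ≡⟨ *-assoc (m ^ k) (m + k) (y ^ k) ⟨
    m ^ k * (m + k) * y ^ k      ≤⟨ *-monoˡ-≤ (y ^ k) (bernoulli m k) ⟩
    suc m ^ k * m * y ^ k        ≡⟨ lemma₁ (suc m ^ k) m (y ^ k) ⟩
    m * (suc m ^ k * y ^ k)      ≡⟨ cong (m *_) (^-distribʳ-* (suc m) y k) ⟨
    m * (suc m * y) ^ k          ≤⟨ *-monoʳ-≤ m (^-monoˡ-≤ k hyp) ⟩
    m * (m * x) ^ k              ≡⟨ cong (m *_) (^-distribʳ-* m x k) ⟩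
    m * (m ^ k * x ^ k)          ≡⟨ lemma₂ m (m ^ k) (x ^ k) ⟩
    m ^ k * (m * x ^ k)          ∎))
    where
    open ≤-Reasoning
    k : ℕ
    k = m * H
    m≢0 : NonZero m
    m≢0 = >-nonZero 1≤m
    lemma₁ : ∀ a m b → a * m * b ≡ m * (a * b)
    lemma₁ = solve-∀
    lemma₂ : ∀ m a b → m * (a * b) ≡ a * (m * b)
    lemma₂ = solve-∀

  exponent-trade : ∀ H q y k a e → 1 ≤ H → 1 ≤ k → H * y ^ k ≤ (q * H) ^ k → k * a ≤ e → y ^ e ≤ q ^ e * H ^ (e ∸ a)
  exponent-trade H q y k a e 1≤H 1≤k hyp ka≤e = *-cancelʳ-≤ (y ^ e) (q ^ e * H ^ (e ∸ a)) (H ^ a) {{m^n≢0 H a {{H≢0}}}} (begin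
    y ^ e * H ^ a                   ≤⟨ ^-cancelʳ-≤ k 1≤k raised ⟩
    (q * H) ^ e                     ≡⟨ ^-distribʳ-* q H e ⟩
    q ^ e * H ^ e                   ≡⟨ cong (λ t → q ^ e * H ^ t) (m∸n+n≡m a≤e) ⟨
    q ^ e * H ^ (e ∸ a + a)         ≡⟨ cong (q ^ e *_) (^-distribˡ-+-* H (e ∸ a) a) ⟩
    q ^ e * (H ^ (e ∸ a) * H ^ a)   ≡⟨ *-assoc (q ^ e) _ _ ⟨
    q ^ e * H ^ (e ∸ a) * H ^ a     ∎)
    where
    open ≤-Reasoning
    H≢0 : NonZero H
    H≢0 = >-nonZero 1≤H
    a≤e : a ≤ e
    a≤e = ≤-trans (m≤n*m a k {{>-nonZero 1≤k}}) ka≤e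
    raised : (y ^ e * H ^ a) ^ k ≤ ((q * H) ^ e) ^ k
    raised = begin
      (y ^ e * H ^ a) ^ k         ≡⟨ ^-distribʳ-* (y ^ e) (H ^ a) k ⟩
      (y ^ e) ^ k * (H ^ a) ^ k   ≡⟨ cong₂ _*_ (^-comm y e k) (^-*-assoc H a k) ⟩
      (y ^ k) ^ e * H ^ (a * k)   ≤⟨ *-monoʳ-≤ ((y ^ k) ^ e) (^-monoʳ-≤ H {{H≢0}} (≤-trans (≤-reflexive (*-comm a k)) ka≤e)) ⟩
      (y ^ k) ^ e * H ^ e         ≡⟨ ^-distribʳ-* (y ^ k) H e ⟨
      (y ^ k * H) ^ e             ≤⟨ ^-monoˡ-≤ e (subst (_≤ (q * H) ^ k) (*-comm H (y ^ k)) hyp) ⟩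
      ((q * H) ^ k) ^ e           ≡⟨ ^-comm (q * H) k e ⟩
      ((q * H) ^ e) ^ k           ∎

  growth : ∀ c q y e e′ n M → 1 ≤ e → y ^ e ≤ q ^ e * (c * c) ^ e′ → c ^ (e′ * n) ≤ M ^ e → y ^ n ≤ q ^ n * (M * M)
  growth c q y e e′ n M 1≤e hyp lower = ^-cancelʳ-≤ e 1≤e (begin
    (y ^ n) ^ e                              ≡⟨ ^-comm y n e ⟩
    (y ^ e) ^ n                              ≤⟨ ^-monoˡ-≤ n hyp ⟩
    (q ^ e * (c * c) ^ e′) ^ n               ≡⟨ ^-distribʳ-* (q ^ e) ((c * c) ^ e′) n ⟩
    (q ^ e) ^ n * ((c * c) ^ e′) ^ n         ≡⟨ cong₂ _*_ (^-comm q e n) (trans (^-*-assoc (c * c) e′ n) (^-distribʳ-* c c (e′ * n))) ⟩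
    (q ^ n) ^ e * (c ^ (e′ * n) * c ^ (e′ * n)) ≤⟨ *-monoʳ-≤ ((q ^ n) ^ e) (*-mono-≤ lower lower) ⟩
    (q ^ n) ^ e * (M ^ e * M ^ e)            ≡⟨ cong ((q ^ n) ^ e *_) (^-distribʳ-* M M e) ⟨
    (q ^ n) ^ e * (M * M) ^ e                ≡⟨ ^-distribʳ-* (q ^ n) (M * M) e ⟨
    (q ^ n * (M * M)) ^ e                    ∎)
    where open ≤-Reasoning

  absorb-growth : ∀ p L q n M B → 1 ≤ M → (p * L) ^ n ≤ q ^ n * (M * M) →
                  B * (M * M) ≤ 2 * L ^ n * M ^ n → p ^ n * B ≤ 2 * q ^ n * M ^ n
  absorb-growth p L q n M B 1≤M hyp bound = *-cancelʳ-≤ (p ^ n * B) (2 * q ^ n * M ^ n) (M * M) {{>-nonZero (*-mono-≤ 1≤M 1≤M)}} (begin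
    p ^ n * B * (M * M)               ≡⟨ *-assoc (p ^ n) B (M * M) ⟩
    p ^ n * (B * (M * M))             ≤⟨ *-monoʳ-≤ (p ^ n) bound ⟩
    p ^ n * (2 * L ^ n * M ^ n)       ≡⟨ lemma₁ (p ^ n) (L ^ n) (M ^ n) ⟩
    2 * (p ^ n * L ^ n) * M ^ n       ≡⟨ cong (λ t → 2 * t * M ^ n) (^-distribʳ-* p L n) ⟨
    2 * (p * L) ^ n * M ^ n           ≤⟨ *-monoˡ-≤ (M ^ n) (*-monoʳ-≤ 2 hyp) ⟩
    2 * (q ^ n * (M * M)) * M ^ n     ≡⟨ lemma₂ (q ^ n) (M * M) (M ^ n) ⟩
    2 * q ^ n * M ^ n * (M * M)       ∎)
    where
    open ≤-Reasoning
    lemma₁ : ∀ a b c → a * (2 * b * c) ≡ 2 * (a * b) * c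
    lemma₁ = solve-∀
    lemma₂ : ∀ a b c → 2 * (a * b) * c ≡ 2 * a * c * b
    lemma₂ = solve-∀



open import Defs
open import Data.Bool using (Bool; true; false)
open import Data.Nat using (ℕ; zero; suc; _+_; _*_; _∸_; _^_; _≤_; _<_; z≤n; s≤s; >-nonZero)
open import Data.Nat.Properties
open import Data.Nat.Tactic.RingSolver using (solve-∀)
open import Data.Integer as ℤ using (ℤ; +_)
import Data.Integer.Properties as ℤ
open import Data.List using (List; length; upTo)
open import Data.List.Properties using (length-++; length-map; length-upTo)
open import Data.List.Membership.Propositional using (_∈_)
open import Data.List.Membership.Propositional.Properties using (∈-map⁺)
open import Data.Product using (_×_; _,_; ∃-syntax)
open import Relation.Binary.PropositionalEquality
open import Relation.Nullary using (contradiction)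
open Counting using (sumBy)
open Summation
open Exponents

length-posList : ∀ d → length (posList d) ≡ d
length-posList d = trans (length-map (λ i → + suc i) (upTo d)) (length-upTo d)

length-Cd : ∀ d → length (Cd d) ≡ d + d
length-Cd d = trans (length-++ (posList d))
  (cong₂ _+_ (length-posList d) (trans (length-map ℤ.-_ (posList d)) (length-posList d)))

length-Cset≥2 : ∀ withZero d → 1 ≤ d → 2 ≤ length (Cset withZero d)
length-Cset≥2 withZero d 1≤d = ≤-trans (≤-trans (+-mono-≤ 1≤d 1≤d) (≤-reflexive (sym (length-Cd d)))) (Cd≤Cset withZero)
  where
  Cd≤Cset : ∀ withZero → length (Cd d) ≤ length (Cset withZero d)
  Cd≤Cset true  = n≤1+n _
  Cd≤Cset false = ≤-refl

0∈Dset : ∀ {C z} → z ∈ C → + 0 ∈ Dset C z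
0∈Dset {C} {z} z∈C = subst (_∈ Dset C z) (ℤ.+-inverseʳ z) (∈-map⁺ (λ w → w ℤ.- z) z∈C)

small-size⇒σ₀>0 : ∀ {c n δa δb} (σ : ℤ → ℕ) → 2 ≤ c → 1 ≤ n → c * δa < δb →
       profileSize n σ * (c * (c ∸ 1) * δb) ≤ ((c ∸ 1) * (c ∸ 1) * δb + δa * c) * n → 1 ≤ σ (+ 0)
small-size⇒σ₀>0 σ _ _ _ _ with σ (+ 0)
... | suc _ = s≤s z≤n
small-size⇒σ₀>0 {suc c} {n} {δa} {δb} σ (s≤s 1≤c) 1≤n cδa<δb size | zero = contradiction cδa<δb (≤⇒≯ (begin
  δb                     ≤⟨ m≤n*m δb c {{>-nonZero 1≤c}} ⟩
  c * δb                 ≤⟨ +-cancelˡ-≤ (c * c * δb) _ _ (≤-trans (≤-reflexive (lemma c δb)) cancelled) ⟩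
  δa * suc c             ≡⟨ *-comm δa (suc c) ⟩
  suc c * δa             ∎))
  where
  open ≤-Reasoning
  lemma : ∀ c δb → c * c * δb + c * δb ≡ suc c * c * δb
  lemma = solve-∀
  cancelled : suc c * c * δb ≤ c * c * δb + δa * suc c
  cancelled = *-cancelʳ-≤ _ _ n {{>-nonZero 1≤n}} (≤-trans (≤-reflexive (*-comm (suc c * c * δb) n)) size)

positive-base : ∀ {c M e} k → 1 ≤ c → 1 ≤ e → c ^ k ≤ M ^ e → 1 ≤ M
positive-base {M = zero}  {suc e} k 1≤c _ cᵏ≤0 = ≤-trans (^-positive k 1≤c) cᵏ≤0
positive-base {M = suc M}         _ _   _ _    = s≤s z≤n

bernoulli-hypothesis : ∀ L H → suc L ≤ H → suc (suc (2 * L)) * (suc (2 * L) * L) ≤ suc (2 * L) * (2 * L * H)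
bernoulli-hypothesis L H sucL≤H = begin
  suc (suc (2 * L)) * (suc (2 * L) * L) ≡⟨ lemma L ⟩
  suc (2 * L) * (2 * L * suc L)         ≤⟨ *-monoʳ-≤ (suc (2 * L)) (*-monoʳ-≤ (2 * L) sucL≤H) ⟩
  suc (2 * L) * (2 * L * H)             ∎
  where
  open ≤-Reasoning
  lemma : ∀ L → suc (suc (2 * L)) * (suc (2 * L) * L) ≡ suc (2 * L) * (2 * L * suc L)
  lemma = solve-∀

-- L = 2|C| − 1 bounds the weight of D; the rate p/q = 1 + 1/(2L) keeps pL/q = L + 1/2 below |C|²,
-- and K is large enough for the remaining gap to absorb the loss εa/εb in the exponent of M.
module Constants (c : ℕ) where

  L q p H K : ℕ
  L = 2 * c ∸ 1
  q = 2 * L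
  p = suc q
  H = c * c
  K = p * H + c

  sucL≤H : 2 ≤ c → suc L ≤ H
  sucL≤H 2≤c = subst (_≤ H) (sym (trans (+-comm 1 L) (m∸n+n≡m {2 * c} (≤-trans (s≤s z≤n) (*-monoʳ-≤ 2 2≤c))))) (*-monoˡ-≤ c 2≤c)

  exponent-gap : 2 ≤ c → ∀ εa εb → K * εa < εb → (p * L) ^ εb ≤ q ^ εb * H ^ (εb ∸ εa)
  exponent-gap 2≤c εa εb Kεa<εb =
    exponent-trade H q (p * L) (p * H) εa εb 1≤H (*-mono-≤ (s≤s (z≤n {q})) 1≤H)
      (bernoulli-power p H (q * H) (p * L) (s≤s z≤n) (bernoulli-hypothesis L H (sucL≤H 2≤c)))
      (≤-trans (*-monoˡ-≤ εa (m≤m+n (p * H) c)) (<⇒≤ Kεa<εb))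
    where
    1≤H : 1 ≤ H
    1≤H = *-mono-≤ (≤-trans (s≤s z≤n) 2≤c) (≤-trans (s≤s z≤n) 2≤c)

mainTheorem10 :
  ∀ (withZero : Bool) (d : ℕ) → 1 ≤ d →
  ∃[ K ] (1 ≤ K ×
    (∀ (εa εb δa δb : ℕ) → 1 ≤ εa → K * εa < εb → 1 ≤ δa → K * δa < δb →
      ∃[ cn ] ∃[ cd ] ∃[ p ] ∃[ q ] ∃[ A ] ∃[ n₀ ]
        (1 ≤ cn × 1 ≤ cd × q < p ×
          (∀ (n : ℕ) → n₀ ≤ n → ∀ (τ : ℤ) (M : ℕ) (z : ℤ) (σ : ℤ → ℕ) →
            length (Cset withZero d) ^ ((εb ∸ εa) * n) ≤ M ^ εb →
            M ^ εb ≤ length (Cset withZero d) ^ ((εb + εa) * n) →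
            z ∈ Cset withZero d → z ≢ + 0 →
            isProfile (Dset (Cset withZero d) z) n σ →
            profileSize n σ * (length (Cset withZero d) * (length (Cset withZero d) ∸ 1) * δb)
              ≤ ((length (Cset withZero d) ∸ 1) * (length (Cset withZero d) ∸ 1) * δb
                 + δa * length (Cset withZero d)) * n →
            p ^ n * badCount (Dset (Cset withZero d) z) σ τ z cn cd n M ≤ A * q ^ n * M ^ n))))
mainTheorem10 withZero d 1≤d = K , ≤-trans 1≤c (m≤n+m c (p * H)) , λ εa εb δa δb _ Kεa<εb _ Kδa<δb →
  1 , 2 , p , q , 2 , 1 , ≤-refl , s≤s z≤n , ≤-refl , λ n 1≤n τ M z σ lower _ z∈C z≢0 _ size →
    let 1≤εb : 1 ≤ εb
        1≤εb = ≤-trans (s≤s z≤n) Kεa<εb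
        0∈D : + 0 ∈ Dset C z
        0∈D = 0∈Dset z∈C
        cδa<δb : c * δa < δb
        cδa<δb = ≤-<-trans (*-monoˡ-≤ δa (m≤n+m c (p * H))) Kδa<δb
    in absorb-growth p L q n M _ (positive-base ((εb ∸ εa) * n) 1≤c 1≤εb lower)
         (growth c q (p * L) εb (εb ∸ εa) n M 1≤εb (exponent-gap 2≤c εa εb Kεa<εb) lower)
         (≤-trans (badCount-bound (Dset C z) σ τ z n M 0∈D (small-size⇒σ₀>0 σ 2≤c 1≤n cδa<δb size) z≢0)
                  (*-monoˡ-≤ (M ^ n) (*-monoʳ-≤ 2 (^-monoˡ-≤ n (weight≤L 0∈D)))))
  where
  C : List ℤ
  C = Cset withZero d
  c : ℕ
  c = length C
  open Constants c
  2≤c : 2 ≤ c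
  2≤c = length-Cset≥2 withZero d 1≤d
  1≤c : 1 ≤ c
  1≤c = ≤-trans (s≤s z≤n) 2≤c
  weight≤L : ∀ {z} → + 0 ∈ Dset C z → sumBy weight (Dset C z) ≤ L
  weight≤L {z} 0∈D = ∸-monoˡ-≤ 1 (subst (λ l → sumBy weight (Dset C z) < 2 * l) (length-map _ C) (sumBy-weight< 0∈D))
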